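{- Let $A$ be a setoid, $B$ a setoid family over $A$ and $(C,a_C)$ a $P_B$-algebra. For every $(F,R)$ in $\mathsf{RFam}$ and every $w:W$, the function $(a_C\circ(\mathsf{cmprh}\,F))\circ m_w:\mathsf{ImS}\,w\Rightarrow C$ is recursively defined, i.e. $\mathsf{RecDef}\,w\,((a_C\circ(\mathsf{cmprh}\,F))\circ m_w)$ is inhabited.
   Context: Setting: intensional Martin-Löf type theory with $\Pi$-types and a universe $\mathsf{U}$ closed under $\Pi$ and containing intensional $\Sigma$-types, identity types, the unit type, W-types and dependent W-types (inductive families); logic is propositions-as-types. A setoid $X$ is a tuple $(X_0,\approx_X,r_X,s_X,t_X)$ with $X_0:\mathsf{U}$, $\approx_X:X_0\to X_0\to\mathsf{U}$ and witnesses of reflexivity, symmetry, transitivity; $x:X$ means $x:X_0$. An extensional function $f:X\Rightarrow Y$ is $f_0:X_0\to Y_0$ with a proof of $\prod_{x,x'}x\approx x'\to f_0x\approx f_0x'$; the setoid $X\Rightarrow Y$ has $f\approx g:=\prod_x f_0x\approx g_0x$. A setoid family $B$ over a setoid $A$ gives a setoid $B\,a$ (underlying type $B_0a$) for $a:A$ and extensional transports $B_\alpha:B\,a\Rightarrow B\,a'$ for $\alpha:a\approx_Aa'$, functorial up to $\approx$, with $B_\alpha\approx B_{\alpha'}$ for all $\alpha,\alpha':a\approx a'$. Write $b\approx_\alpha b'$ for $B_\alpha b\approx b'$. $P_BX$ is the setoid on $\sum_{a:A_0}(B\,a\Rightarrow X)$ with $(a,k)\approx(a',k'):=\sum_{\alpha:a\approx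 a'}k\approx k'\circ B_\alpha$. A $P_B$-algebra is a setoid $C$ with extensional $a_C:P_BC\Rightarrow C$. $\mathrm{W}$ is the W-type on $A_0,B_0$ with constructor $\mathsf{sup}$, and $\mathsf{n}(\mathsf{sup}\,a\,f)\equiv a$, $\mathsf{b}(\mathsf{sup}\,a\,f)\equiv f$. $\mathcal{W}_B$ is the inductive family on $\mathrm{W}\times\mathrm{W}$ with single constructor $\mathsf{dsup}\,(w,w')\,\alpha\,\phi:\mathcal{W}_B\,w\,w'$ for $\alpha:\mathsf{n}w\approx_A\mathsf{n}w'$ and $\phi:\prod_{(b,b',\beta):\sum_{b,b'}b\approx_\alpha b'}\mathcal{W}_B(\mathsf{b}\,w\,b)(\mathsf{b}\,w'\,b')$. The setoid $W$ has underlying type $\sum_w\mathcal{W}_B\,w\,w$ and $(w,\_)\approx_W(w',\_):=\mathcal{W}_B\,w\,w'$. For $\gamma:w\approx_Ww'$, $\mathsf{n}\triangleright\gamma:\mathsf{n}w\approx_A\mathsf{n}w'$ is its label component; each $\mathsf{b}\,w:B(\mathsf{n}w)\Rightarrow W$ is extensional. For $w:W$, $\mathsf{ImS}\,w$ is the setoid on $B_0(\mathsf{n}w)$ with $s\approx s':=\mathsf{b}\,w\,s\approx_W\mathsf{b}\,w\,s'$; for $\gamma:w\approx_Ww'$, $\mathsf{ImS}_\gamma:=B_{\mathsf{n}\triangleright\gamma}$. $e_w:B(\mathsf{n}w)\Rightarrow\mathsf{ImS}\,w$ is the identity on underlying types and $m_w:\mathsf{ImS}\,w\Rightarrow W$ has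 underlying function $\mathsf{b}\,w$. $\mathsf{CohMaps}\,w$ is the setoid of families $F:\prod_{s:\mathsf{ImS}\,w}\mathsf{ImS}(\mathsf{b}\,w\,s)\Rightarrow C$ such that $F\,s\approx(F\,s')\circ\mathsf{ImS}_\sigma$ for all $\sigma:\mathsf{b}\,w\,s\approx_W\mathsf{b}\,w\,s'$. For $F:\mathsf{CohMaps}\,w$, $\mathsf{recst}\,w\,F:\mathsf{ImS}\,w\Rightarrow C$ is $s\mapsto a_C(\mathsf{n}(\mathsf{b}\,w\,s),(F\,s)\circ e_{\mathsf{b}ws})$. For $k:\mathsf{ImS}\,w\Rightarrow C$, $\mathsf{RecDef}\,w\,k$ is the inductive family (dependent W-type indexed by $\sum_{w:W}(\mathsf{ImS}\,w\Rightarrow C)$) with the single constructor: from $F:\mathsf{CohMaps}\,w$, a proof of $k\approx\mathsf{recst}\,w\,F$ and $\prod_{s:B_0(\mathsf{n}w)}\mathsf{RecDef}\,(\mathsf{b}\,w\,s)\,(F\,s)$, form an element of $\mathsf{RecDef}\,w\,k$. $\mathsf{RFam}$ is the setoid of pairs $(F,R)$ with $F:\prod_{w:W}\mathsf{ImS}\,w\Rightarrow C$ and $R:\prod_w\mathsf{RecDef}\,w\,(F\,w)$, with $(F,\_)\approx(F',\_):=\prod_wF\,w\approx F'\,w$. For $(F,R)$ in $\mathsf{RFam}$, $F$ is coherent ($F\,w\approx(F\,w')\circ\mathsf{ImS}_\gamma$ for all $\gamma:w\approx_Ww'$) and $\mathsf{cmprh}\,F:W\Rightarrow P_BC$ is the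 extensional function $w\mapsto(\mathsf{n}\,w,(F\,w)\circ e_w)$. -}

module Defs where

open import Level using (0ℓ)
open import Data.Product using (Σ; Σ-syntax; _,_; proj₁; proj₂)
open import Relation.Binary.Bundles using (Setoid)
open import Function.Bundles using (Func)
import Function.Construct.Composition as Comp
import Function.Relation.Binary.Setoid.Equality as FunEq

open Func public using (to)

-- Setoids are stdlib setoids with carrier and relation in the universe
-- Set (= U).  Extensional functions X ⇒ Y are stdlib 'Func X Y'; the
-- setoid X ⇒ Y is the pointwise setoid '_⇨_'.

Std : Set₁
Std = Setoid 0ℓ 0ℓ

infixr 9 _∘F_
_∘F_ : {X Y Z : Std} → Func Y Z → Func X Y → Func X Z
g ∘F f = Comp.function f g

infix 4 _≈⇒_
_≈⇒_ : {X Y : Std} → Func X Y → Func X Y → Set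
_≈⇒_ {X} {Y} f g = FunEq._≈_ X Y f g

idF : {X : Std} → Func X X
idF = record { to = λ x → x ; cong = λ e → e }

record SetoidFamily (A : Std) : Set₁ where
  open Setoid A using () renaming (Carrier to A₀; _≈_ to _≈A_; refl to reflA; trans to transA)
  field
    fib     : A₀ → Std
    tr      : {a a' : A₀} → a ≈A a' → Func (fib a) (fib a')
    tr-id   : {a : A₀} → tr (reflA {a}) ≈⇒ idF {fib a}
    tr-comp : {a a' a'' : A₀} (α : a ≈A a') (β : a' ≈A a'') →
              tr (transA α β) ≈⇒ (tr β ∘F tr α)
    tr-irr  : {a a' : A₀} (α α' : a ≈A a') → tr α ≈⇒ tr α'

module Construction {A : Std} (B : SetoidFamily A) where

  open Setoid A using () renaming
    (Carrier to A₀; _≈_ to _≈A_; refl to reflA; sym to symA; trans to transA)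
  open SetoidFamily B public

  B₀ : A₀ → Set
  B₀ a = Setoid.Carrier (fib a)

  module _ {a : A₀} where
    open Setoid (fib a) public using () renaming
      (_≈_ to _≈B_; refl to reflB; sym to symB; trans to transB)

  _≈[_]_ : {a a' : A₀} → B₀ a → a ≈A a' → B₀ a' → Set
  b ≈[ α ] b' = to (tr α) b ≈B b'

  tr-self : {a : A₀} (α : a ≈A a) (x : B₀ a) → to (tr α) x ≈B x
  tr-self α x = transB (tr-irr α reflA x) (tr-id x)

  tr-inv : {a a' : A₀} (α : a ≈A a') (x : B₀ a') → to (tr α) (to (tr (symA α)) x) ≈B x
  tr-inv α x = transB (symB (tr-comp (symA α) α x)) (tr-self (transA (symA α) α) x)

  P : Std → Std
  P X = record
    { Carrier = Σ[ a ∈ A₀ ] Func (fib a) X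
    ; _≈_ = λ { (a , k) (a' , k') → Σ[ α ∈ a ≈A a' ] (k ≈⇒ (k' ∘F tr α)) }
    ; isEquivalence = record
      { refl = λ { {a , k} → reflA , λ x → Func.cong k (symB (tr-id x)) }
      ; sym = λ { {a , k} {a' , k'} (α , e) → symA α , λ x →
                  X.trans (Func.cong k' (symB (tr-inv α x))) (X.sym (e (to (tr (symA α)) x))) }
      ; trans = λ { {a , k} {a' , k'} {a'' , k''} (α , e) (β , f) → transA α β , λ x →
                  X.trans (e x) (X.trans (f (to (tr α) x)) (Func.cong k'' (symB (tr-comp α β x)))) }
      }
    }
    where module X = Setoid X

  record PAlg : Set₁ where
    field
      C  : Std
      aC : Func (P C) C

  data 𝕎 : Set where
    sup : (a : A₀) → (B₀ a → 𝕎) → 𝕎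

  n : 𝕎 → A₀
  n (sup a f) = a

  b : (w : 𝕎) → B₀ (n w) → 𝕎
  b (sup a f) = f

  data 𝒲 : 𝕎 → 𝕎 → Set where
    dsup : (w w' : 𝕎) (α : n w ≈A n w') →
           ((t : Σ[ s ∈ B₀ (n w) ] Σ[ s' ∈ B₀ (n w') ] (s ≈[ α ] s')) →
              𝒲 (b w (proj₁ t)) (b w' (proj₁ (proj₂ t)))) →
           𝒲 w w'

  sym𝒲 : {w w' : 𝕎} → 𝒲 w w' → 𝒲 w' w
  sym𝒲 (dsup w w' α φ) = dsup w' w (symA α) λ { (s' , s , β) →
    sym𝒲 (φ (s , s' , transB (Func.cong (tr α) (symB β)) (tr-inv α s'))) }

  trans𝒲 : {w w' w'' : 𝕎} → 𝒲 w w' → 𝒲 w' w'' → 𝒲 w w''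
  trans𝒲 (dsup w w' α φ) (dsup _ w'' α' ψ) = dsup w w'' (transA α α') λ { (s , s'' , β) →
    trans𝒲 (φ (s , to (tr α) s , reflB)) (ψ (to (tr α) s , s'' , transB (symB (tr-comp α α' s)) β)) }

  -- the setoid W: underlying type Σ w, 𝒲 w w and (w , _) ≈ (w' , _) := 𝒲 w w'
  -- (the relation is wrapped in a one-field record only to help type inference)
  W₀ : Set
  W₀ = Σ[ w ∈ 𝕎 ] 𝒲 w w

  infix 4 _≈W_
  record _≈W_ (x y : W₀) : Set where
    constructor ⟨_⟩
    field un : 𝒲 (proj₁ x) (proj₁ y)
  open _≈W_ public

  W : Std
  W = record
    { Carrier = W₀
    ; _≈_ = _≈W_
    ; isEquivalence = record
      { refl = λ { {_ , p} → ⟨ p ⟩ }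
      ; sym = λ γ → ⟨ sym𝒲 (un γ) ⟩
      ; trans = λ γ δ → ⟨ trans𝒲 (un γ) (un δ) ⟩ } }

  nW : W₀ → A₀
  nW w = n (proj₁ w)

  n▷ : {w w' : W₀} → w ≈W w' → nW w ≈A nW w'
  n▷ ⟨ dsup _ _ α _ ⟩ = α

  private
    diag : {w : 𝕎} → 𝒲 w w → (s : B₀ (n w)) → 𝒲 (b w s) (b w s)
    diag (dsup _ _ α φ) s = φ (s , s , tr-self α s)

    bcong : {w : 𝕎} → 𝒲 w w → {s s' : B₀ (n w)} → s ≈B s' → 𝒲 (b w s) (b w s')
    bcong (dsup _ _ α φ) {s} {s'} e = φ (s , s' , transB (tr-self α s) e)

  bW : (w : W₀) → Func (fib (nW w)) W
  bW (w , p) = record { to = λ s → b w s , diag p s ; cong = λ e → ⟨ bcong p e ⟩ }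

  ImS : W₀ → Std
  ImS w = record
    { Carrier = B₀ (nW w)
    ; _≈_ = λ s s' → to (bW w) s ≈W to (bW w) s'
    ; isEquivalence = record
      { refl = λ {s} → Setoid.refl W {to (bW w) s}
      ; sym = Setoid.sym W ; trans = Setoid.trans W } }

  b-tr : {w w' : W₀} (γ : w ≈W w') (s : B₀ (nW w)) →
         to (bW w) s ≈W to (bW w') (to (tr (n▷ γ)) s)
  b-tr ⟨ dsup _ _ α φ ⟩ s = ⟨ φ (s , to (tr α) s , reflB) ⟩

  ImS-tr : {w w' : W₀} (γ : w ≈W w') → Func (ImS w) (ImS w')
  ImS-tr {w} {w'} γ = record
    { to = to (tr (n▷ γ))
    ; cong = λ {s} {s'} σ →
        Setoid.trans W (Setoid.sym W (b-tr γ s)) (Setoid.trans W σ (b-tr γ s')) }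

  e : (w : W₀) → Func (fib (nW w)) (ImS w)
  e w = record { to = λ s → s ; cong = Func.cong (bW w) }

  m : (w : W₀) → Func (ImS w) W
  m w = record { to = to (bW w) ; cong = λ σ → σ }

  module Algebra (C : Std) (aC : Func (P C) C) where

    module C = Setoid C

    _⇒_ : Std → Std → Std
    X ⇒ Y = FunEq._⇨_ X Y

    CohMaps : W₀ → Std
    CohMaps w = record
      { Carrier = Σ[ F ∈ ((s : B₀ (nW w)) → Func (ImS (to (bW w) s)) C) ]
                  ((s s' : B₀ (nW w)) (σ : to (bW w) s ≈W to (bW w) s') →
                     F s ≈⇒ (F s' ∘F ImS-tr σ))
      ; _≈_ = λ F F' → (s : B₀ (nW w)) → proj₁ F s ≈⇒ proj₁ F' s
      ; isEquivalence = record
        { refl = λ _ _ → C.refl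
        ; sym = λ p s x → C.sym (p s x)
        ; trans = λ p q s x → C.trans (p s x) (q s x) } }

    recst : (w : W₀) → Setoid.Carrier (CohMaps w) → Func (ImS w) C
    recst w (F , coh) = record
      { to = λ s → to aC (nW (to (bW w) s) , F s ∘F e (to (bW w) s))
      ; cong = λ {s} {s'} σ → Func.cong aC (n▷ σ , coh s s' σ) }

    data RecDef : (w : W₀) → Func (ImS w) C → Set where
      recdef : {w : W₀} {k : Func (ImS w) C} (F : Setoid.Carrier (CohMaps w)) →
               k ≈⇒ recst w F →
               ((s : B₀ (nW w)) → RecDef (to (bW w) s) (proj₁ F s)) →
               RecDef w k

    RFam : Std
    RFam = record
      { Carrier = Σ[ F ∈ ((w : W₀) → Func (ImS w) C) ] ((w : W₀) → RecDef w (F w))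
      ; _≈_ = λ F F' → (w : W₀) → proj₁ F w ≈⇒ proj₁ F' w
      ; isEquivalence = record
        { refl = λ _ _ → C.refl
        ; sym = λ p w x → C.sym (p w x)
        ; trans = λ p q w x → C.trans (p w x) (q w x) } }

    RecDef-coh : {w w' : W₀} {k : Func (ImS w) C} {k' : Func (ImS w') C} →
                 RecDef w k → RecDef w' k' → (γ : w ≈W w') → k ≈⇒ (k' ∘F ImS-tr γ)
    RecDef-coh (recdef (G₁ , c₁) e₁ r₁) (recdef (G₂ , c₂) e₂ r₂) γ s =
      C.trans (e₁ s)
        (C.trans (Func.cong aC (n▷ (b-tr γ s) , RecDef-coh (r₁ s) (r₂ (to (tr (n▷ γ)) s)) (b-tr γ s)))
          (C.sym (e₂ (to (tr (n▷ γ)) s))))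

    coherent : (FR : Setoid.Carrier RFam) {w w' : W₀} (γ : w ≈W w') →
               proj₁ FR w ≈⇒ (proj₁ FR w' ∘F ImS-tr γ)
    coherent (F , R) {w} {w'} γ = RecDef-coh (R w) (R w') γ

    cmprh : Setoid.Carrier RFam → Func W (P C)
    cmprh FR = record
      { to = λ w → nW w , proj₁ FR w ∘F e w
      ; cong = λ γ → n▷ γ , coherent FR γ }

module Submission where

-- For (F , R) in RFam the map a_C ∘ cmprh F ∘ m w
-- unfolds into the family obtained by restricting F to the children of w:
--
--   * a coherent family F on all of W restricts, for each w, to an element
--     of CohMaps w (coherence of F along the equalities σ between children);
--   * the one-step unfolding recst w of this restriction sends s to
--     a_C (n (b w s) , F (b w s) ∘ e), which is by definition the value of
--     a_C ∘ cmprh F ∘ m w at s;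
--   * each restricted component F (b w s) is recursively defined by R.
--
-- These three facts are exactly the three arguments of the constructor of
-- RecDef, so the theorem follows in one step.

open import Defs
open import Relation.Binary.Bundles using (Setoid)
open import Function.Bundles using (Func)
open import Data.Product using (_,_; proj₁; proj₂)

module _ {A : Std} (B : SetoidFamily A) (C : Std)
         (aC : Func (Construction.P B C) C) where
  open Construction B
  open Algebra C aC

  Coherent : ((w : W₀) → Func (ImS w) C) → Set
  Coherent F = {w w' : W₀} (γ : w ≈W w') → F w ≈⇒ (F w' ∘F ImS-tr γ)

  restrict : (F : (w : W₀) → Func (ImS w) C) → Coherent F →
             (w : W₀) → Setoid.Carrier (CohMaps w)
  restrict F coh w = (λ s → F (to (bW w) s)) , (λ s s' σ → coh σ)

  -- The one-step unfolding of the restriction of F is a_C ∘ cmprh F ∘ m w;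
  -- both sides compute a_C (n (b w s) , F (b w s) ∘ e) at every s.
  unfold-restrict : (FR : Setoid.Carrier RFam) (w : W₀) →
                    ((aC ∘F cmprh FR) ∘F m w)
                      ≈⇒ recst w (restrict (proj₁ FR) (coherent FR) w)
  unfold-restrict FR w s = C.refl

lemma3p15 : (A : Std) (B : SetoidFamily A) (C : Std)
            (aC : Func (Construction.P B C) C) →
            let open Construction B
                open Algebra C aC
            in (FR : Setoid.Carrier RFam) (w : W₀) →
               RecDef w ((aC ∘F cmprh FR) ∘F m w)
lemma3p15 A B C aC FR w =
  recdef (restrict B C aC (proj₁ FR) (coherent FR) w)
         (unfold-restrict B C aC FR w)
         (λ s → proj₂ FR (to (bW w) s))
  where open Construction B
        open Algebra C aC
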